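{- Let $\$=\langle 1,c_2,c_3\rangle$ be a coin system (natural numbers $1<c_2<c_3$). If $\$$ is non-canonical, then for every natural number $c_4>c_3$ the coin system $\$'=\langle 1,c_2,c_3,c_4\rangle$ is also non-canonical.
   Context: A coin system is a tuple $\langle c_1,\dots,c_m\rangle$ of natural numbers with $1=c_1<c_2<\cdots<c_m$. A representation of $x$ is a tuple $(\alpha_1,\dots,\alpha_m)$ of natural numbers with $\sum_i\alpha_ic_i=x$, of size $\sum_i\alpha_i$. The greedy representation $\mathrm{GRD}(x)$ is the representation with $\sum_{j<i}\alpha_jc_j<c_i$ for all $2\le i\le m$; $\mathrm{OPT}(x)$ is a representation of minimum size. The system is canonical if $|\mathrm{GRD}(x)|=|\mathrm{OPT}(x)|$ for all $x$, and non-canonical otherwise. -}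

module Defs where

open import Data.Nat using (ℕ; zero; suc; _+_; _*_; _≤_; _<_)
open import Data.Fin using (Fin; toℕ)
open import Data.Vec using (Vec; lookup; _∷_; [])
open import Data.Product using (_×_)
import Data.Fin
open import Relation.Binary.PropositionalEquality using (_≡_)
open import Relation.Nullary using (¬_)

-- Coin systems ⟨1,c_2,…,c_m⟩ are given as Vec ℕ m; the conditions 1=c_1<c_2<… are stated as explicit hypotheses in the statement.

Rep : ℕ → Set
Rep m = Vec ℕ m

value : ∀ {m} → Vec ℕ m → Rep m → ℕ
value [] [] = 0
value (c ∷ cs) (a ∷ as) = a * c + value cs as

size : ∀ {m} → Rep m → ℕ
size [] = 0
size (a ∷ as) = a + size as

IsRepOf : ∀ {m} → Vec ℕ m → ℕ → Rep m → Set
IsRepOf c x a = value c a ≡ x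

prefixValue : ∀ {m} → Vec ℕ m → Rep m → ℕ → ℕ
prefixValue c a zero = 0
prefixValue [] [] (suc i) = 0
prefixValue (c ∷ cs) (a ∷ as) (suc i) = a * c + prefixValue cs as i

-- greedy representation: ∑_{j<i} α_j c_j < c_i for every coin index i ≥ 2 (1-based)
IsGreedy : ∀ {m} → Vec ℕ m → ℕ → Rep m → Set
IsGreedy {m} c x a =
  IsRepOf c x a × (∀ (i : Fin m) → 1 Data.Nat.≤ toℕ i → prefixValue c a (toℕ i) Data.Nat.< lookup c i)

IsOpt : ∀ {m} → Vec ℕ m → ℕ → Rep m → Set
IsOpt c x a = IsRepOf c x a × (∀ b → IsRepOf c x b → size a ≤ size b)

Canonical : ∀ {m} → Vec ℕ m → Set
Canonical c = ∀ (x : ℕ) (g o : Rep _) → IsGreedy c x g → IsOpt c x o → size g ≡ size o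

NonCanonical : ∀ {m} → Vec ℕ m → Set
NonCanonical c = ¬ Canonical c

-- Write b = q a + r with 0 ≤ r < a.  The greedy size of z in ⟨1,a⟩ is z % a + z / a; when r = 0
-- or q + r ≥ a, every extra coin b raises it by at least one, so no representation of x beats
-- GRD(x) in ⟨1,a,b⟩.  Hence non-canonicity of ⟨1,a,b⟩ forces 0 < r and q + r < a, and then every
-- c > b has an explicit counterexample: a + b when c ≤ a + b − 2; (q + 1) a = b + (a − r) when
-- c > b + (a − r); otherwise r = 1 and c = a + b − 1, and 2 b = c + (q − 1) a + 2 needs q + 2
-- greedy coins against 2.

module Submission where

open import Data.Nat
open import Data.Nat.Properties
open import Algebra.Properties.CommutativeSemigroup +-commutativeSemigroup using (x∙yz≈xz∙y; xy∙z≈y∙xz)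
open import Data.Nat.DivMod
open import Data.Nat.Divisibility using (n∣m*n)
open import Data.Nat.Induction using (<-wellFounded)
open import Data.Nat.Tactic.RingSolver using (solve-∀)
open import Data.Vec using (Vec; _∷_; []; lookup)
open import Data.Fin using (zero; suc; toℕ)
open import Data.Product using (∃; _×_; _,_)
open import Data.Sum using (_⊎_; inj₁; inj₂)
open import Data.Empty using (⊥-elim)
open import Function using (_on_)
open import Induction.WellFounded using (Acc; acc)
open import Relation.Binary.Construct.On as On using ()
open import Relation.Nullary using (¬_; yes; no; contradiction)
open import Relation.Binary.PropositionalEquality

open import Defs

-- Refuting canonicity is a negative goal, so the double negation of the existence of an
-- optimal representation is all we need, and that holds without any decidability of sizes.
¬¬optimal : ∀ {m} (c : Vec ℕ m) {x} h → IsRepOf c x h → ¬ ¬ ∃ (IsOpt c x)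
¬¬optimal c {x} h = go h (On.wellFounded size <-wellFounded h)
  where
  go : ∀ h → Acc (_<_ on size) h → IsRepOf c x h → ¬ ¬ ∃ (IsOpt c x)
  go h (acc smaller) h-rep noOpt = noOpt (h , h-rep , minimal)
    where
    minimal : ∀ b → IsRepOf c x b → size h ≤ size b
    minimal b b-rep with size h ≤? size b
    ... | yes h≤b = h≤b
    ... | no h≰b = ⊥-elim (go b (smaller (≰⇒> h≰b)) b-rep noOpt)

nonCanonical-witness : ∀ {m} {c : Vec ℕ m} {x g} →
  IsGreedy c x g → ∀ h → IsRepOf c x h → size h < size g → NonCanonical c
nonCanonical-witness {c = c} {x} {g} g-greedy h h-rep h<g canonical =
  ¬¬optimal c h h-rep λ (o , o-opt@(_ , o-min)) →
    <⇒≱ h<g (≤-trans (≤-reflexive (canonical x g o g-greedy o-opt)) (o-min h h-rep))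

module TwoCoins (a : ℕ) .{{_ : NonZero a}} where

  cost : ℕ → ℕ
  cost z = z % a + z / a

  cost-+* : ∀ u s → cost (u + s * a) ≡ cost u + s
  cost-+* u s = begin
    (u + s * a) % a + (u + s * a) / a
      ≡⟨ cong₂ _+_ ([m+kn]%n≡m%n u s a) (+-distrib-/-∣ʳ u (n∣m*n s)) ⟩
    u % a + (u / a + s * a / a)  ≡⟨ cong (λ k → u % a + (u / a + k)) (m*n/n≡m s a) ⟩
    u % a + (u / a + s)          ≡⟨ +-assoc (u % a) (u / a) s ⟨
    cost u + s                   ∎
    where open ≡-Reasoning

  cost-digit : ∀ {t} → t < a → cost t ≡ t
  cost-digit t<a = trans (cong₂ _+_ (m<n⇒m%n≡m t<a) (m<n⇒m/n≡0 t<a)) (+-identityʳ _)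

  cost-digits : ∀ {t} s → t < a → cost (t + s * a) ≡ t + s
  cost-digits {t} s t<a = trans (cost-+* t s) (cong (_+ s) (cost-digit t<a))

  cost-≤ : ∀ u s → cost (u + s * a) ≤ u + s
  cost-≤ u s = begin
    cost (u + s * a)       ≡⟨ cost-+* u s ⟩
    u % a + u / a + s      ≤⟨ +-monoˡ-≤ s (+-monoʳ-≤ (u % a) (m≤m*n (u / a) a)) ⟩
    u % a + u / a * a + s  ≡⟨ cong (_+ s) (m≡m%n+[m/n]*n u a) ⟨
    u + s                  ∎
    where open ≤-Reasoning

  cost-carry : ∀ {t r q} → t < a → r < a → 0 < q → r ≡ 0 ⊎ a ≤ q + r → suc t ≤ cost (t + r) + q
  cost-carry {t} {r} {q} t<a r<a 0<q r≡0⊎a≤q+r with t + r <? a | r≡0⊎a≤q+r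
  ... | yes t+r<a | _ = begin
    suc t                 ≡⟨ +-comm 1 t ⟩
    t + 1                 ≤⟨ +-mono-≤ (m≤m+n t r) 0<q ⟩
    t + r + q             ≡⟨ cong (_+ q) (cost-digit t+r<a) ⟨
    cost (t + r) + q      ∎
    where open ≤-Reasoning
  ... | no t+r≮a | inj₁ refl = contradiction (subst (_< a) (sym (+-identityʳ t)) t<a) t+r≮a
  ... | no t+r≮a | inj₂ a≤q+r with m≤n⇒∃[o]m+o≡n (≮⇒≥ t+r≮a)
  ...   | t′ , a+t′≡t+r = begin
    suc t                 ≤⟨ s≤s t≤t′+q ⟩
    suc t′ + q            ≡⟨ cong (_+ q) (+-comm 1 t′) ⟩
    t′ + 1 + q            ≡⟨ cong (_+ q) cost[t+r]≡t′+1 ⟨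
    cost (t + r) + q      ∎
    where
    open ≤-Reasoning
    t′<a : t′ < a
    t′<a = +-cancelˡ-< a t′ a (subst (_< a + a) (sym a+t′≡t+r) (+-mono-< t<a r<a))
    cost[t+r]≡t′+1 : cost (t + r) ≡ t′ + 1
    cost[t+r]≡t′+1 = begin-equality
      cost (t + r)       ≡⟨ cong cost (trans (sym a+t′≡t+r) (trans (+-comm a t′) (cong (t′ +_) (sym (*-identityˡ a))))) ⟩
      cost (t′ + 1 * a)  ≡⟨ cost-digits 1 t′<a ⟩
      t′ + 1             ∎
    t≤t′+q : t ≤ t′ + q
    t≤t′+q = +-cancelˡ-≤ a t (t′ + q) (begin
      a + t              ≤⟨ +-monoˡ-≤ t a≤q+r ⟩
      q + r + t          ≡⟨ +-assoc q r t ⟩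
      q + (r + t)        ≡⟨ cong (q +_) (trans (+-comm r t) (sym a+t′≡t+r)) ⟩
      q + (a + t′)       ≡⟨ +-comm q (a + t′) ⟩
      a + t′ + q         ≡⟨ +-assoc a t′ q ⟩
      a + (t′ + q)       ∎)

  module _ {b q r : ℕ} (b≡r+q*a : b ≡ r + q * a) (r<a : r < a) (0<q : 0 < q) (r≡0⊎a≤q+r : r ≡ 0 ⊎ a ≤ q + r) where

    cost-+coin : ∀ z → suc (cost z) ≤ cost (z + b)
    cost-+coin z = begin
      suc t + s                   ≤⟨ +-monoˡ-≤ s (cost-carry (m%n<n z a) r<a 0<q r≡0⊎a≤q+r) ⟩
      cost (t + r) + q + s        ≡⟨ x∙yz≈xz∙y (cost (t + r)) s q ⟨
      cost (t + r) + (s + q)      ≡⟨ cost-+* (t + r) (s + q) ⟨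
      cost (t + r + (s + q) * a)  ≡⟨ cong cost regroup ⟩
      cost (z + b)                ∎
      where
      open ≤-Reasoning
      t = z % a
      s = z / a
      regroup : t + r + (s + q) * a ≡ z + b
      regroup = begin-equality
        t + r + (s + q) * a       ≡⟨ digits t r s q a ⟩
        (t + s * a) + (r + q * a) ≡⟨ cong₂ _+_ (m≡m%n+[m/n]*n z a) b≡r+q*a ⟨
        z + b                     ∎
        where
        digits : ∀ t r s q a → t + r + (s + q) * a ≡ (t + s * a) + (r + q * a)
        digits = solve-∀

    cost-+coins : ∀ n y → n + cost y ≤ cost (y + n * b)
    cost-+coins zero y = ≤-reflexive (cong cost (sym (+-identityʳ y)))
    cost-+coins (suc n) y = begin
      suc (n + cost y)          ≤⟨ s≤s (cost-+coins n y) ⟩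
      suc (cost (y + n * b))    ≤⟨ cost-+coin (y + n * b) ⟩
      cost (y + n * b + b)      ≡⟨ cong cost (trans (+-assoc y (n * b) b) (cong (y +_) (+-comm (n * b) b))) ⟩
      cost (y + suc n * b)      ∎
      where open ≤-Reasoning

greedy-topCount-≥ : ∀ {b y y′ g o} → y < b → y + g * b ≡ y′ + o * b → o ≤ g
greedy-topCount-≥ {b} {y} {y′} {g} {o} y<b same = ≮⇒≥ λ g<o → <-irrefl same (begin-strict
  y + g * b    <⟨ +-monoˡ-< (g * b) y<b ⟩
  suc g * b    ≤⟨ *-monoˡ-≤ b g<o ⟩
  o * b        ≤⟨ m≤n+m (o * b) y′ ⟩
  y′ + o * b   ∎)
  where open ≤-Reasoning

greedy-topCount-split : ∀ {b y y′ g o} → y < b → y + g * b ≡ y′ + o * b →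
  ∃ λ n → o + n ≡ g × y + n * b ≡ y′
greedy-topCount-split {b} {y} {y′} {g} {o} y<b same with m≤n⇒∃[o]m+o≡n (greedy-topCount-≥ {g = g} y<b same)
... | n , o+n≡g = n , o+n≡g , +-cancelʳ-≡ (o * b) (y + n * b) y′ (begin
  y + n * b + o * b    ≡⟨ +-assoc y (n * b) (o * b) ⟩
  y + (n * b + o * b)  ≡⟨ cong (y +_) (trans (cong (_* b) (+-comm o n)) (*-distribʳ-+ b n o)) ⟨
  y + (o + n) * b      ≡⟨ cong (λ k → y + k * b) o+n≡g ⟩
  y + g * b            ≡⟨ same ⟩
  y′ + o * b           ∎)
  where open ≡-Reasoning

value-⟨1,a,b⟩ : ∀ a b n₁ n₂ n₃ → value (1 ∷ a ∷ b ∷ []) (n₁ ∷ n₂ ∷ n₃ ∷ []) ≡ n₁ + n₂ * a + n₃ * b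
value-⟨1,a,b⟩ = unfolded
  where
  unfolded : ∀ a b n₁ n₂ n₃ → n₁ * 1 + (n₂ * a + (n₃ * b + 0)) ≡ n₁ + n₂ * a + n₃ * b
  unfolded = solve-∀

greedy-⟨1,a,b⟩⇒ : ∀ {a b x n₁ n₂ n₃} → IsGreedy (1 ∷ a ∷ b ∷ []) x (n₁ ∷ n₂ ∷ n₃ ∷ []) →
  n₁ < a × n₁ + n₂ * a < b
greedy-⟨1,a,b⟩⇒ {a} {b} {n₁ = n₁} (_ , prefix<coin) =
  subst (_< a) (trans (+-identityʳ _) (*-identityʳ n₁)) (prefix<coin (suc zero) (s≤s z≤n)) ,
  subst (_< b) (cong₂ _+_ (*-identityʳ n₁) (+-identityʳ _)) (prefix<coin (suc (suc zero)) (s≤s z≤n))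

canonical-⟨1,a,b⟩ : ∀ {a b q r} .{{_ : NonZero a}} →
  b ≡ r + q * a → r < a → 0 < q → r ≡ 0 ⊎ a ≤ q + r → Canonical (1 ∷ a ∷ b ∷ [])
canonical-⟨1,a,b⟩ {a} {b} b≡r+q*a r<a 0<q r≡0⊎a≤q+r x
  g@(g₁ ∷ g₂ ∷ g₃ ∷ []) (o₁ ∷ o₂ ∷ o₃ ∷ []) g-greedy@(g-rep , _) (o-rep , o-minimal)
  with greedy-⟨1,a,b⟩⇒ g-greedy
... | g₁<a , yg<b with greedy-topCount-split {g = g₃} {o = o₃} yg<b
      (trans (sym (value-⟨1,a,b⟩ a b g₁ g₂ g₃)) (trans g-rep (trans (sym o-rep) (value-⟨1,a,b⟩ a b o₁ o₂ o₃))))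
...   | n , refl , yg+nb≡yo = ≤-antisym (begin
    g₁ + (g₂ + (o₃ + n + 0))         ≡⟨ regroup g₁ g₂ o₃ n ⟩
    n + (g₁ + g₂) + o₃               ≡⟨ cong (λ k → n + k + o₃) (cost-digits g₂ g₁<a) ⟨
    n + cost (g₁ + g₂ * a) + o₃      ≤⟨ +-monoˡ-≤ o₃ (cost-+coins b≡r+q*a r<a 0<q r≡0⊎a≤q+r n _) ⟩
    cost (g₁ + g₂ * a + n * b) + o₃  ≡⟨ cong (λ k → cost k + o₃) yg+nb≡yo ⟩
    cost (o₁ + o₂ * a) + o₃          ≤⟨ +-monoˡ-≤ o₃ (cost-≤ o₁ o₂) ⟩
    o₁ + o₂ + o₃                     ≡⟨ regroup′ o₁ o₂ o₃ ⟩
    o₁ + (o₂ + (o₃ + 0))             ∎) (o-minimal g g-rep)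
  where
  open TwoCoins a
  open ≤-Reasoning
  regroup : ∀ g₁ g₂ o₃ n → g₁ + (g₂ + (o₃ + n + 0)) ≡ n + (g₁ + g₂) + o₃
  regroup = solve-∀
  regroup′ : ∀ o₁ o₂ o₃ → o₁ + o₂ + o₃ ≡ o₁ + (o₂ + (o₃ + 0))
  regroup′ = solve-∀

nonCanonical-⟨1,a,b⟩⇒ : ∀ {a b q r} .{{_ : NonZero a}} → b ≡ r + q * a → r < a → 0 < q →
  NonCanonical (1 ∷ a ∷ b ∷ []) → 0 < r × q + r < a
nonCanonical-⟨1,a,b⟩⇒ {r = zero} b≡r+q*a r<a 0<q nonCanonical =
  contradiction (canonical-⟨1,a,b⟩ b≡r+q*a r<a 0<q (inj₁ refl)) nonCanonical
nonCanonical-⟨1,a,b⟩⇒ {a} {q = q} {suc r} b≡r+q*a r<a 0<q nonCanonical with q + suc r <? a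
... | yes q+r<a = z<s , q+r<a
... | no q+r≮a = contradiction (canonical-⟨1,a,b⟩ b≡r+q*a r<a 0<q (inj₂ (≮⇒≥ q+r≮a))) nonCanonical

value-⟨1,a,b,c⟩ : ∀ a b c n₁ n₂ n₃ n₄ →
  value (1 ∷ a ∷ b ∷ c ∷ []) (n₁ ∷ n₂ ∷ n₃ ∷ n₄ ∷ []) ≡ n₁ + n₂ * a + n₃ * b + n₄ * c
value-⟨1,a,b,c⟩ = unfolded
  where
  unfolded : ∀ a b c n₁ n₂ n₃ n₄ →
    n₁ * 1 + (n₂ * a + (n₃ * b + (n₄ * c + 0))) ≡ n₁ + n₂ * a + n₃ * b + n₄ * c
  unfolded = solve-∀

greedy-⟨1,a,b,c⟩ : ∀ {a b c} n₁ n₂ n₃ n₄ → n₁ < a → n₁ + n₂ * a < b → n₁ + n₂ * a + n₃ * b < c →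
  IsGreedy (1 ∷ a ∷ b ∷ c ∷ []) (n₁ + n₂ * a + n₃ * b + n₄ * c) (n₁ ∷ n₂ ∷ n₃ ∷ n₄ ∷ [])
greedy-⟨1,a,b,c⟩ {a} {b} {c} n₁ n₂ n₃ n₄ p₁<a p₂<b p₃<c = value-⟨1,a,b,c⟩ a b c n₁ n₂ n₃ n₄ , prefix<coin
  where
  prefix<coin : ∀ i → 1 ≤ toℕ i →
    prefixValue (1 ∷ a ∷ b ∷ c ∷ []) (n₁ ∷ n₂ ∷ n₃ ∷ n₄ ∷ []) (toℕ i) < lookup (1 ∷ a ∷ b ∷ c ∷ []) i
  prefix<coin (suc zero) _ = subst (_< a) (sym (trans (+-identityʳ _) (*-identityʳ n₁))) p₁<a
  prefix<coin (suc (suc zero)) _ = subst (_< b) (sym (cong₂ _+_ (*-identityʳ n₁) (+-identityʳ _))) p₂<b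
  prefix<coin (suc (suc (suc zero))) _ = subst (_< c) (sym (value-⟨1,a,b⟩ a b n₁ n₂ n₃)) p₃<c

nonCanonical-c+t≡a+b : ∀ {a b c t} → a < b → b < c → c + t ≡ a + b → 2 ≤ t →
  NonCanonical (1 ∷ a ∷ b ∷ c ∷ [])
nonCanonical-c+t≡a+b {a} {b} {c} {t} a<b b<c c+t≡a+b 2≤t =
  nonCanonical-witness (greedy-⟨1,a,b,c⟩ t 0 0 1 t<a t<b t<c)
    (0 ∷ 1 ∷ 1 ∷ 0 ∷ []) a+b≡t+c (subst (2 <_) (+-comm 1 t) (s≤s 2≤t))
  where
  t<a : t < a
  t<a = +-cancelˡ-< b t a (begin-strict
    b + t  <⟨ +-monoˡ-< t b<c ⟩
    c + t  ≡⟨ trans c+t≡a+b (+-comm a b) ⟩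
    b + a  ∎)
    where open ≤-Reasoning
  t<b : t + 0 * a < b
  t<b = subst (_< b) (sym (+-identityʳ t)) (<-trans t<a a<b)
  t<c : t + 0 * a + 0 * b < c
  t<c = subst (_< c) (sym (+-identityʳ (t + 0))) (<-trans t<b b<c)
  a+b≡t+c : value (1 ∷ a ∷ b ∷ c ∷ []) (0 ∷ 1 ∷ 1 ∷ 0 ∷ []) ≡ t + 0 * a + 0 * b + 1 * c
  a+b≡t+c = begin
    value (1 ∷ a ∷ b ∷ c ∷ []) (0 ∷ 1 ∷ 1 ∷ 0 ∷ [])  ≡⟨ value-⟨1,a,b,c⟩ a b c 0 1 1 0 ⟩
    0 + 1 * a + 1 * b + 0 * c                          ≡⟨ lhs a b c ⟩
    a + b                                              ≡⟨ c+t≡a+b ⟨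
    c + t                                              ≡⟨ rhs a b c t ⟩
    t + 0 * a + 0 * b + 1 * c                          ∎
    where
    open ≡-Reasoning
    lhs : ∀ a b c → 0 + 1 * a + 1 * b + 0 * c ≡ a + b
    lhs = solve-∀
    rhs : ∀ a b c t → c + t ≡ t + 0 * a + 0 * b + 1 * c
    rhs = solve-∀

nonCanonical-b+d<c : ∀ {a b c q r d} → 0 < r → r + d ≡ a → b ≡ r + q * a → a < b → q < d → b + d < c →
  NonCanonical (1 ∷ a ∷ b ∷ c ∷ [])
nonCanonical-b+d<c {a} {b} {c} {q} {r} {d} 0<r r+d≡a b≡r+q*a a<b q<d b+d<c =
  nonCanonical-witness (greedy-⟨1,a,b,c⟩ d 0 1 0 d<a d<b d+b<c)
    (0 ∷ suc q ∷ 0 ∷ 0 ∷ []) [1+q]a≡d+b (subst₂ _<_ (sym (+-identityʳ (suc q))) (+-comm 1 d) (s≤s q<d))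
  where
  d<a : d < a
  d<a = subst (d <_) r+d≡a (m<n+m d 0<r)
  d<b : d + 0 * a < b
  d<b = subst (_< b) (sym (+-identityʳ d)) (<-trans d<a a<b)
  d+b<c : d + 0 * a + 1 * b < c
  d+b<c = subst (_< c) (norm a b d) b+d<c
    where
    norm : ∀ a b d → b + d ≡ d + 0 * a + 1 * b
    norm = solve-∀
  [1+q]a≡d+b : value (1 ∷ a ∷ b ∷ c ∷ []) (0 ∷ suc q ∷ 0 ∷ 0 ∷ []) ≡ d + 0 * a + 1 * b + 0 * c
  [1+q]a≡d+b = begin
    value (1 ∷ a ∷ b ∷ c ∷ []) (0 ∷ suc q ∷ 0 ∷ 0 ∷ [])  ≡⟨ value-⟨1,a,b,c⟩ a b c 0 (suc q) 0 0 ⟩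
    0 + suc q * a + 0 * b + 0 * c                          ≡⟨ lhs a b c q ⟩
    a + q * a                                              ≡⟨ cong (_+ q * a) r+d≡a ⟨
    r + d + q * a                                          ≡⟨ xy∙z≈y∙xz r d (q * a) ⟩
    d + (r + q * a)                                        ≡⟨ cong (d +_) b≡r+q*a ⟨
    d + b                                                  ≡⟨ rhs a b c d ⟩
    d + 0 * a + 1 * b + 0 * c                              ∎
    where
    open ≡-Reasoning
    lhs : ∀ a b c q → 0 + suc q * a + 0 * b + 0 * c ≡ a + q * a
    lhs = solve-∀
    rhs : ∀ a b c d → d + b ≡ d + 0 * a + 1 * b + 0 * c
    rhs = solve-∀

nonCanonical-c+1≡a+b : ∀ {a b c q} → 2 < a → b ≡ 1 + q * a → 0 < q → c + 1 ≡ a + b →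
  NonCanonical (1 ∷ a ∷ b ∷ c ∷ [])
nonCanonical-c+1≡a+b {a} {b} {c} {suc q′} 2<a b≡1+q*a (s≤s z≤n) c+1≡a+b =
  nonCanonical-witness (greedy-⟨1,a,b,c⟩ 2 q′ 0 1 2<a 2+q′a<b 2+q′a<c)
    (0 ∷ 0 ∷ 2 ∷ 0 ∷ []) 2b≡2+q′a+c (s≤s (s≤s (m≤n+m 1 q′)))
  where
  c≡a+qa : c ≡ a + suc q′ * a
  c≡a+qa = +-cancelʳ-≡ 1 c (a + suc q′ * a)
    (trans c+1≡a+b (trans (cong (a +_) b≡1+q*a) (x∙yz≈xz∙y a 1 (suc q′ * a))))
  3+q′a≤a+q′a : 3 + q′ * a ≤ a + q′ * a
  3+q′a≤a+q′a = +-monoˡ-≤ (q′ * a) 2<a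
  2+q′a<b : 2 + q′ * a < b
  2+q′a<b = subst (2 + q′ * a <_) (sym b≡1+q*a) (m<n⇒m<1+n 3+q′a≤a+q′a)
  2+q′a<c : 2 + q′ * a + 0 * b < c
  2+q′a<c = subst₂ _<_ (sym (+-identityʳ (2 + q′ * a))) (sym c≡a+qa) (≤-trans 3+q′a≤a+q′a (m≤n+m _ a))
  2b≡2+q′a+c : value (1 ∷ a ∷ b ∷ c ∷ []) (0 ∷ 0 ∷ 2 ∷ 0 ∷ []) ≡ 2 + q′ * a + 0 * b + 1 * c
  2b≡2+q′a+c = trans (value-⟨1,a,b,c⟩ a b c 0 0 2 0)
    (subst₂ (λ b c → 0 + 0 * a + 2 * b + 0 * c ≡ 2 + q′ * a + 0 * b + 1 * c) (sym b≡1+q*a) (sym c≡a+qa)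
      (identity a q′))
    where
    identity : ∀ a q′ → 0 + 0 * a + 2 * (1 + suc q′ * a) + 0 * (a + suc q′ * a)
                        ≡ 2 + q′ * a + 0 * (1 + suc q′ * a) + 1 * (a + suc q′ * a)
    identity = solve-∀

nonCanonical-⟨1,a,b,c⟩ : ∀ {a b c q r} → b ≡ r + q * a → 0 < r → q + r < a → 0 < q → a < b → b < c →
  NonCanonical (1 ∷ a ∷ b ∷ c ∷ [])
nonCanonical-⟨1,a,b,c⟩ {a} {b} {c} {q} {r} b≡r+q*a 0<r q+r<a 0<q a<b b<c
  with m≤n⇒∃[o]m+o≡n (≤-trans (m≤n+m r q) (<⇒≤ q+r<a)) | c + 2 ≤? a + b
... | _ | yes c+2≤a+b with m≤n⇒∃[o]m+o≡n c+2≤a+b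
...   | k , c+2+k≡a+b = nonCanonical-c+t≡a+b a<b b<c (trans (sym (+-assoc c 2 k)) c+2+k≡a+b) (m≤m+n 2 k)
nonCanonical-⟨1,a,b,c⟩ {a} {b} {c} {q} {r} b≡r+q*a 0<r q+r<a 0<q a<b b<c
    | d , r+d≡a | no c+2≰a+b with b + d <? c
... | yes b+d<c = nonCanonical-b+d<c 0<r r+d≡a b≡r+q*a a<b q<d b+d<c
  where
  q<d : q < d
  q<d = +-cancelʳ-< r q d (subst (q + r <_) (trans (sym r+d≡a) (+-comm r d)) q+r<a)
... | no b+d≮c = nonCanonical-c+1≡a+b 2<a (subst (λ r → b ≡ r + q * a) r≡1 b≡r+q*a) 0<q c+1≡a+b
  where
  a+b≤c+1 : a + b ≤ c + 1
  a+b≤c+1 = ≤-pred (subst (a + b <_) (+-suc c 1) (≰⇒> c+2≰a+b))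
  c+r≤a+b : c + r ≤ a + b
  c+r≤a+b = begin
    c + r        ≤⟨ +-monoˡ-≤ r (≮⇒≥ b+d≮c) ⟩
    b + d + r    ≡⟨ x∙yz≈xz∙y b r d ⟨
    b + (r + d)  ≡⟨ trans (cong (b +_) r+d≡a) (+-comm b a) ⟩
    a + b        ∎
    where open ≤-Reasoning
  r≡1 : r ≡ 1
  r≡1 = ≤-antisym (+-cancelˡ-≤ c r 1 (≤-trans c+r≤a+b a+b≤c+1)) 0<r
  c+1≡a+b : c + 1 ≡ a + b
  c+1≡a+b = ≤-antisym (subst (λ r → c + r ≤ a + b) r≡1 c+r≤a+b) a+b≤c+1
  2<a : 2 < a
  2<a = ≤-trans (s≤s (+-mono-≤ 0<q 0<r)) q+r<a

lemma1 : (c₂ c₃ : ℕ) → 1 < c₂ → c₂ < c₃ →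
    NonCanonical (1 ∷ c₂ ∷ c₃ ∷ []) →
    (c₄ : ℕ) → c₃ < c₄ → NonCanonical (1 ∷ c₂ ∷ c₃ ∷ c₄ ∷ [])
lemma1 c₂ c₃ 1<c₂ c₂<c₃ nonCanonical c₄ c₃<c₄ =
  let 0<r , q+r<c₂ = nonCanonical-⟨1,a,b⟩⇒ c₃≡r+q*c₂ (m%n<n c₃ c₂) 0<q nonCanonical
  in nonCanonical-⟨1,a,b,c⟩ c₃≡r+q*c₂ 0<r q+r<c₂ 0<q c₂<c₃ c₃<c₄
  where
  instance
    c₂-nonZero : NonZero c₂
    c₂-nonZero = >-nonZero (<-trans z<s 1<c₂)
  c₃≡r+q*c₂ : c₃ ≡ c₃ % c₂ + c₃ / c₂ * c₂
  c₃≡r+q*c₂ = m≡m%n+[m/n]*n c₃ c₂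
  0<q : 0 < c₃ / c₂
  0<q = m≥n⇒m/n>0 (<⇒≤ c₂<c₃)
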